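{- Let $G$, $\mathcal{H}$, $\mu$, $t$, $x_i$, $n$, and the sets $S_i$, $B_i$ be as in the context. Suppose $\{e_{i_1},\ldots,e_{i_p}\}\subseteq E(G)$ with $p=l_1+l_\mu$, and the spanning subgraph $G'$ of $G$ with edge set $\{e_{i_1},\ldots,e_{i_p}\}$ contains a cycle with $l_1+l_\mu$ edges. If $e_{\mu+r}\in\{e_{i_1},\ldots,e_{i_p}\}$ for some $0\le r\le t-1$, then $$\left|\bigcap_{j=1}^p S_{i_j}\right| - \left|\bigcap_{j=1}^p B_{i_j}\right| = -x_{\mu+r}\,m^{n-l_1-l_\mu}.$$
   Context: Let $G=\Theta(l_1,\ldots,l_k)$ (two end vertices $u,w$ joined by $k$ internally disjoint paths of lengths $l_1,\ldots,l_k$), where $k\ge 2$, $l_2\le\cdots\le l_k$, $l_2\ge\max\{l_1,2\}$, and $l_1$ has different parity from $l_j$ for every $j\in\{2,\ldots,k\}$. The vertices of the $i$th path are $u, v_{i,1},\ldots,v_{i,l_i-1},w$ (if $l_1=1$, $v_{1,1}$ means $w$). Let $l=\sum_{i=1}^k l_i$ and $n=l+2-k=|V(G)|$. For $i\in[k]$ let $e_i=uv_{i,1}$, and name the remaining edges so that $E(G)=\{e_i: i\in[l]\}$; write $e_i=y_iz_i$. Let $m\in\mathbb{N}$. A cover of $G$ is a pair $\mathcal{H}=(L,H)$ with $H$ a graph and $L:V(G)\to\mathcal{P}(V(H))$ such that $\{L(x)\}$ partitions $V(H)$, each $H[L(x)]$ is complete, edges of $H$ between $L(x)$ and $L(y)$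 for $x\ne y$ exist only if $xy\in E(G)$, and for $xy\in E(G)$ the set $E_H(L(x),L(y))$ of such edges is a matching; it is $m$-fold if all $|L(x)|=m$, and full if each such matching for $xy\in E(G)$ is perfect. Here $\mathcal{H}=(L,H)$ is a full $m$-fold cover of $G$ with $L(x)=\{(x,j):j\in[m]\}$ for each $x\in V(G)$ and $(x,j)(y,j)\in E(H)$ for every $xy\in E(G)\setminus\{e_2,\ldots,e_k\}$ and $j\in[m]$. For $i\in\{2,\ldots,k\}$, $x_i$ is the number of edges in $E_H(L(u),L(v_{i,1}))$ joining vertices with different second coordinates. Assume some $x_i>0$ and let $\mu$ be the smallest $i\in\{2,\ldots,k\}$ with $x_i>0$. Suppose precisely $t$ of the integers $l_1,\ldots,l_k$ equal $l_\mu$, and that $l_\mu=l_{\mu+1}=\cdots=l_{\mu+t-1}$. Let $\mathcal{U}=\{I\subseteq V(H): |L(x)\cap I|=1 \text{ for all } x\in V(G)\}$. For $i\in[l]$, $S_i$ is the set of $I\in\mathcal{U}$ such that $H[I]$ contains an edge of $E_H(L(y_i),L(z_i))$, and $B_i$ is the set of all maps $V(G)\to[m]$ that give $y_i$ and $z_i$ the same value. -}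

module Defs where

open import Data.Nat using (ℕ; zero; suc; pred; _+_; _∸_; _≤_; _<_; s≤s; z≤n)
open import Data.Nat.Properties using (_<?_; pred-mono-≤)
open import Data.Fin using (Fin; zero; suc; toℕ; fromℕ<; inject₁; fromℕ)
open import Data.Fin.Properties using (_≟_)
open import Data.Fin.Permutation using (Permutation′; _⟨$⟩ʳ_)
open import Data.List using (List; []; _∷_; [_]; map; concatMap; length; filter; allFin)
open import Data.Nat.ListAction using (sum)
open import Data.List.Membership.Propositional using (_∈_)
open import Data.List.Relation.Unary.All using (All; all?)
open import Data.Vec using (Vec; []; _∷_; lookup)
open import Data.Product using (Σ; _×_; _,_)
open import Data.Sum using (_⊎_)
open import Relation.Binary.PropositionalEquality using (_≡_)
open import Relation.Nullary using (yes; no; ¬?)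
open import Relation.Unary using (Pred; Decidable)
open import Level using (0ℓ)

-- The theta graph Θ(l₁,…,l_k).  Paths are indexed by Fin k (index 0 = path 1,
-- index 1 = path 2, …); l i is the length of path i.
data Vertex {k : ℕ} (l : Fin k → ℕ) : Set where
  u w : Vertex l
  -- inner i s  is  v_{i, s+1}   (s = 0 … l_i - 2)
  inner : (i : Fin k) → Fin (pred (l i)) → Vertex l

pos : {k : ℕ} (l : Fin k → ℕ) → Fin k → ℕ → Vertex l
pos l i zero = u
pos l i (suc s) with suc s <? l i
... | yes p = inner i (fromℕ< (pred-mono-≤ p))
... | no _  = w

-- Edges: edge j (j = 0 … l_i - 1) of path i joins positions j and j+1.
-- Edge (i , 0) is e_{i} = u v_{i,1}.
Edge : {k : ℕ} (l : Fin k → ℕ) → Set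
Edge {k} l = Σ (Fin k) (λ i → Fin (l i))

end₁ end₂ : {k : ℕ} (l : Fin k → ℕ) → Edge l → Vertex l
end₁ l (i , j) = pos l i (toℕ j)
end₂ l (i , j) = pos l i (suc (toℕ j))

Joins : {k : ℕ} (l : Fin k → ℕ) → Edge l → Vertex l → Vertex l → Set
Joins l e x y = (end₁ l e ≡ x × end₂ l e ≡ y) ⊎ (end₁ l e ≡ y × end₂ l e ≡ x)

-- The spanning subgraph with edge set F contains a cycle with c edges:
-- a closed walk w₀ w₁ … w_c = w₀ with w₀,…,w_{c-1} distinct, c ≥ 3,
-- each consecutive pair joined by an edge of F.
HasCycle : {k : ℕ} (l : Fin k → ℕ) → List (Edge l) → ℕ → Set
HasCycle l F c =
  Σ (Fin (suc c) → Vertex l) λ v →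
    (3 ≤ c) × (v zero ≡ v (fromℕ c)) ×
    (∀ a b → v (inject₁ a) ≡ v (inject₁ b) → a ≡ b) ×
    (∀ (j : Fin c) → Σ (Edge l) λ e → e ∈ F × Joins l e (v (inject₁ j)) (v (suc j)))

-- the full m-fold cover H: L(x) = {(x,a) : a ∈ Fin m}; σ i is the perfect
-- matching on e_i = u v_{i,1}:  (u,a) ~ (v_{i,1}, σ i a); all other edges of
-- G carry the identity matching (σ at index 0 is required to be the identity).
-- For an edge e = y z (y = end₁, z = end₂), (y,a) ~ (z,b) in H iff b ≡ match e a.
match : {k m : ℕ} (l : Fin k → ℕ) → (Fin k → Permutation′ m) → Edge l → Fin m → Fin m
match l σ (i , j) a with toℕ j
... | zero  = σ i ⟨$⟩ʳ a
... | suc _ = a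

-- x_i : number of edges of E_H(L(u),L(v_{i,1})) joining different second coordinates
xcount : {m : ℕ} → Permutation′ m → ℕ
xcount {m} π = length (filter (λ a → ¬? ((π ⟨$⟩ʳ a) ≟ a)) (allFin m))

-- Enumeration of all maps Vertex l → Fin m (each exactly once, given by the
-- values at u, at w, and a vector of values on the internal vertices of each path).
allVec : (m n : ℕ) → List (Vec (Fin m) n)
allVec m zero = [ [] ]
allVec m (suc n) = concatMap (λ a → map (a ∷_) (allVec m n)) (allFin m)

consD : {k m : ℕ} (f : Fin (suc k) → ℕ) → Vec (Fin m) (f zero) →
        ((i : Fin k) → Vec (Fin m) (f (suc i))) → (i : Fin (suc k)) → Vec (Fin m) (f i)
consD f v g zero = v
consD f v g (suc i) = g i

allDep : (m k : ℕ) (f : Fin k → ℕ) → List ((i : Fin k) → Vec (Fin m) (f i))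
allDep m zero f = [ (λ ()) ]
allDep m (suc k) f =
  concatMap (λ v → map (consD f v) (allDep m k (λ i → f (suc i)))) (allVec m (f zero))

toMap : {k m : ℕ} (l : Fin k → ℕ) → Fin m → Fin m →
        ((i : Fin k) → Vec (Fin m) (pred (l i))) → Vertex l → Fin m
toMap l a b g u = a
toMap l a b g w = b
toMap l a b g (inner i s) = lookup (g i) s

allMaps : {k : ℕ} (m : ℕ) (l : Fin k → ℕ) → List (Vertex l → Fin m)
allMaps {k} m l =
  concatMap (λ a → concatMap (λ b → map (toMap l a b) (allDep m k (λ i → pred (l i))))
                             (allFin m))
            (allFin m)

countMaps : {k : ℕ} (m : ℕ) (l : Fin k → ℕ) {P : Pred (Vertex l → Fin m) 0ℓ} →
            Decidable P → ℕ
countMaps m l P? = length (filter P? (allMaps m l))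

-- f ∈ S_e : the transversal {(x, f x)} induces an edge of E_H(L(y),L(z))
InS : {k m : ℕ} (l : Fin k → ℕ) → (Fin k → Permutation′ m) → Edge l → (Vertex l → Fin m) → Set
InS l σ e f = match l σ e (f (end₁ l e)) ≡ f (end₂ l e)

InB : {k m : ℕ} (l : Fin k → ℕ) → Edge l → (Vertex l → Fin m) → Set
InB l e f = f (end₁ l e) ≡ f (end₂ l e)

sizeS : {k : ℕ} (m : ℕ) (l : Fin k → ℕ) → (Fin k → Permutation′ m) → List (Edge l) → ℕ
sizeS m l σ F = countMaps m l {λ f → All (λ e → InS l σ e f) F} (λ f → all? (λ e → match l σ e (f (end₁ l e)) ≟ f (end₂ l e)) F)

sizeB : {k : ℕ} (m : ℕ) (l : Fin k → ℕ) → List (Edge l) → ℕ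
sizeB m l F = countMaps m l {λ f → All (λ e → InB l e f) F} (λ f → all? (λ e → f (end₁ l e) ≟ f (end₂ l e)) F)

totalLen : {k : ℕ} → (Fin k → ℕ) → ℕ
totalLen {k} l = sum (map l (allFin k))

-- n = |V(G)| = l + 2 - k
nVert : {k : ℕ} → (Fin k → ℕ) → ℕ
nVert {k} l = totalLen l + 2 ∸ k

{-# OPTIONS --safe #-}
-- The l₁ + l_μ edges of the given cycle are distinct members of F, which has exactly that many
-- entries, so F is the edge set of the cycle.  A cycle in Θ that uses one edge of a path uses the
-- whole path, because it enters and leaves each inner vertex it visits along the two path edges
-- there.  Hence F consists of whole paths, path ν among them; any other one has length at most
-- l₁ and so, by the parity hypothesis, is path 1 (index zero).  A map V(G) → [m] lies in every B_e
-- iff it takes one value a on u, w and the inner vertices of paths 1 and ν, and in every S_e iff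
-- moreover σ_ν fixes a, the matching along path 1 being the identity.  The other n − l₁ − l_μ
-- vertices are free, so |⋂ S_e| = (m − x_ν) m^(n − l₁ − l_μ) and |⋂ B_e| = m · m^(n − l₁ − l_μ).
module Submission where

open import Defs
open import Algebra.Properties.CommutativeSemigroup using (x∙yz≈y∙xz)
open import Data.Bool using (true; false; if_then_else_)
open import Data.Empty using (⊥; ⊥-elim)
open import Data.Fin using (Fin; zero; suc; toℕ; fromℕ; fromℕ<; inject₁; splitAt; _↑ˡ_; _↑ʳ_)
open import Data.Fin.Permutation using (Permutation′; _⟨$⟩ʳ_)
open import Data.Fin.Properties
  using (toℕ<n; toℕ-fromℕ<; toℕ-injective; toℕ-inject₁; toℕ-fromℕ; injective⇒≤;
         splitAt⁻¹-↑ˡ; splitAt⁻¹-↑ʳ; any?; ¬∀⟶∃¬)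
  renaming (_≟_ to _≟ᶠ_; all? to allᶠ?; suc-injective to suc-injectiveᶠ)
open import Data.Integer using (+_; -_; _-_)
import Data.Integer.Properties as ℤ
open import Data.List using (List; []; _∷_; length; filter; map; concatMap; allFin; tabulate)
import Data.List as List
open import Data.List.Membership.Propositional using (_∈_)
open import Data.List.Membership.Propositional.Properties using (∈-map⁺; ∈-allFin)
open import Data.List.Properties
  using (length-++; length-map; length-tabulate; map-tabulate; tabulate-cong;
         filter-++; filter-≐; filter-all; filter-none)
open import Data.List.Relation.Unary.All as All using (All)
open import Data.List.Relation.Unary.Any using (index)
open import Data.List.Relation.Unary.Any.Properties using (lookup-index)
open import Data.List.Relation.Unary.Unique.Propositional using (Unique)
open import Data.Nat using (ℕ; zero; suc; pred; _+_; _*_; _^_; _∸_; _≤_; _<_; _%_; z≤n; s≤s; >-nonZero)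
open import Data.Nat.ListAction using (sum)
open import Data.Nat.Properties
  using (_≟_; _<?_; <-cmp; ≤-refl; ≤-reflexive; ≤-trans; ≤-antisym; ≤-pred; ≰⇒>; <⇒≤; <⇒≢; <⇒≱; <-irrefl;
         <-trans; <-≤-trans; ≤∧≢⇒<; n<1+n; n≤1+n; 1+n≢n; m≤m+n; pred-mono-≤; suc-pred; suc-injective;
         +-comm; +-assoc; +-suc; +-cancelˡ-≤; +-monoˡ-<; m+n∸m≡n; *-identityˡ; *-zeroʳ; *-distribʳ-+;
         ^-distribˡ-+-*; +-commutativeSemigroup)
open import Data.Product using (Σ; _×_; _,_; proj₁; proj₂)
open import Data.Product.Properties using (≡-dec)
open import Data.Sum using (_⊎_; inj₁; inj₂)
open import Data.Vec using (Vec; _∷_; lookup)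
open import Data.Vec.Functional using (_++_)
open import Data.Vec.Functional.Relation.Unary.All.Properties using (++⁺)
import Data.Vec.Relation.Unary.All as Vecᴬ
open Vecᴬ using (_∷_)
open import Data.Vec.Relation.Unary.All.Properties using (lookup⁺; lookup⁻)
open import Function using (_∘_; id; _⇔_; mk⇔; Equivalence; Injective)
open import Function.Construct.Composition using (_⇔-∘_)
open import Level using (0ℓ)
open import Relation.Binary using (tri<; tri≈; tri>)
open import Relation.Binary.PropositionalEquality
  using (_≡_; _≢_; refl; sym; trans; cong; cong₂; subst; module ≡-Reasoning)
open import Relation.Nullary using (Dec; does; yes; no; ¬_; ¬?; contradiction; _→-dec_; _⊎-dec_)
open import Relation.Unary using (Pred; Decidable; Universal; U; _≐_)
open import Relation.Unary.Properties using (U?)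

private variable A B : Set

count : {P : Pred A 0ℓ} → Decidable P → List A → ℕ
count P? xs = length (filter P? xs)

module _ {P : Pred A 0ℓ} (P? : Decidable P) where

  count-universal : Universal P → ∀ xs → count P? xs ≡ length xs
  count-universal p xs = cong length (filter-all P? (All.universal p xs))

  count-empty : Universal (¬_ ∘ P) → ∀ xs → count P? xs ≡ 0
  count-empty ¬p xs = cong length (filter-none P? (All.universal ¬p xs))

  count-+-count-¬ : ∀ xs → count P? xs + count (¬? ∘ P?) xs ≡ length xs
  count-+-count-¬ [] = refl
  count-+-count-¬ (x ∷ xs) with P? x
  ... | yes _ = cong suc (count-+-count-¬ xs)
  ... | no _  = trans (+-suc _ _) (cong suc (count-+-count-¬ xs))

  count-map : (g : B → A) → ∀ xs → count P? (map g xs) ≡ count (P? ∘ g) xs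
  count-map g [] = refl
  count-map g (x ∷ xs) with P? (g x)
  ... | yes _ = cong suc (count-map g xs)
  ... | no _  = count-map g xs

  count-concatMap : (f : B → List A) → ∀ xs → count P? (concatMap f xs) ≡ sum (map (count P? ∘ f) xs)
  count-concatMap f [] = refl
  count-concatMap f (x ∷ xs) = trans (cong length (filter-++ P? (f x) (concatMap f xs)))
    (trans (length-++ (filter P? (f x))) (cong (_+_ (count P? (f x))) (count-concatMap f xs)))

length-allFin : ∀ n → length (allFin n) ≡ n
length-allFin n = length-tabulate (λ i → i)

length-concatMap : (f : B → List A) → ∀ xs → length (concatMap f xs) ≡ sum (map (length ∘ f) xs)
length-concatMap f [] = refl
length-concatMap f (x ∷ xs) = trans (length-++ (f x)) (cong (_+_ (length (f x))) (length-concatMap f xs))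

sum-map-const : (f : A → ℕ) {c : ℕ} → (∀ x → f x ≡ c) → ∀ xs → sum (map f xs) ≡ length xs * c
sum-map-const f f≡c [] = refl
sum-map-const f f≡c (x ∷ xs) = cong₂ _+_ (f≡c x) (sum-map-const f f≡c xs)

sum-map-indicator : {R : Pred A 0ℓ} (R? : Decidable R) (f : A → ℕ) {c : ℕ} →
  (∀ {x} → R x → f x ≡ c) → (∀ {x} → ¬ R x → f x ≡ 0) → ∀ xs → sum (map f xs) ≡ count R? xs * c
sum-map-indicator R? f on off [] = refl
sum-map-indicator R? f on off (x ∷ xs) with R? x
... | yes r = cong₂ _+_ (on r) (sum-map-indicator R? f on off xs)
... | no ¬r = cong₂ _+_ (off ¬r) (sum-map-indicator R? f on off xs)

count-≡-allFin : ∀ {n} (a : Fin n) → count (_≟ᶠ a) (allFin n) ≡ 1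
count-≡-allFin {suc n} a =
  trans (cong (count (_≟ᶠ a) ∘ (zero ∷_)) (sym (map-tabulate (λ i → i) suc))) (split a)
  where
  open ≡-Reasoning
  split : ∀ a → count (_≟ᶠ a) (zero ∷ map suc (allFin n)) ≡ 1
  split zero = cong suc (trans (count-map (_≟ᶠ zero) suc (allFin n)) (count-empty _ (λ _ ()) (allFin n)))
  split (suc b) = begin
    count (_≟ᶠ suc b) (map suc (allFin n))  ≡⟨ count-map (_≟ᶠ suc b) suc (allFin n) ⟩
    count (λ i → suc i ≟ᶠ suc b) (allFin n) ≡⟨ cong length (filter-≐ _ (_≟ᶠ b) (suc-injectiveᶠ , cong suc) (allFin n)) ⟩
    count (_≟ᶠ b) (allFin n)                ≡⟨ count-≡-allFin b ⟩
    1                                       ∎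

injective-∈⇒≤-length : ∀ {n} {xs : List A} (g : Fin n → A) → Injective _≡_ _≡_ g →
  (∀ i → g i ∈ xs) → n ≤ length xs
injective-∈⇒≤-length {xs = xs} g g-inj g∈xs = injective⇒≤ index-injective
  where
  open ≡-Reasoning
  index-injective : Injective _≡_ _≡_ (λ i → index (g∈xs i))
  index-injective {i} {j} eq = g-inj (begin
    g i                             ≡⟨ lookup-index (g∈xs i) ⟩
    List.lookup xs (index (g∈xs i)) ≡⟨ cong (List.lookup xs) eq ⟩
    List.lookup xs (index (g∈xs j)) ≡⟨ lookup-index (g∈xs j) ⟨
    g j                             ∎)

++-injective : ∀ {n₁ n₂} {g₁ : Fin n₁ → A} {g₂ : Fin n₂ → A} →
  Injective _≡_ _≡_ g₁ → Injective _≡_ _≡_ g₂ → (∀ i j → g₁ i ≢ g₂ j) → Injective _≡_ _≡_ (g₁ ++ g₂)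
++-injective {n₁ = n₁} {n₂ = n₂} g₁-inj g₂-inj disjoint {i} {j} eq
  with splitAt n₁ i in si | splitAt n₁ j in sj
... | inj₁ x | inj₁ y = trans (sym (splitAt⁻¹-↑ˡ si)) (trans (cong (_↑ˡ n₂) (g₁-inj eq)) (splitAt⁻¹-↑ˡ sj))
... | inj₂ x | inj₂ y = trans (sym (splitAt⁻¹-↑ʳ si)) (trans (cong (n₁ ↑ʳ_) (g₂-inj eq)) (splitAt⁻¹-↑ʳ sj))
... | inj₁ x | inj₂ y = contradiction eq (disjoint x y)
... | inj₂ x | inj₁ y = contradiction (sym eq) (disjoint y x)

length-allVec : ∀ m n → length (allVec m n) ≡ m ^ n
length-allVec m zero = refl
length-allVec m (suc n) = begin
  length (concatMap (λ a → map (a ∷_) (allVec m n)) (allFin m))  ≡⟨ length-concatMap _ (allFin m) ⟩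
  sum (map (λ a → length (map (a ∷_) (allVec m n))) (allFin m)) ≡⟨ sum-map-const _ length-branch (allFin m) ⟩
  length (allFin m) * m ^ n                                       ≡⟨ cong (_* m ^ n) (length-allFin m) ⟩
  m * m ^ n                                                       ∎
  where
  open ≡-Reasoning
  length-branch : ∀ a → length (map (a ∷_) (allVec m n)) ≡ m ^ n
  length-branch a = trans (length-map (a ∷_) (allVec m n)) (length-allVec m n)

Constant : ∀ {m n} → Fin m → Vec (Fin m) n → Set
Constant a = Vecᴬ.All (_≡ a)

constant? : ∀ {m n} (a : Fin m) → Decidable (Constant {n = n} a)
constant? a = Vecᴬ.all? (_≟ᶠ a)

count-constant-allVec : ∀ m n (a : Fin m) → count (constant? a) (allVec m n) ≡ 1
count-constant-allVec m zero a = refl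
count-constant-allVec m (suc n) a = begin
  count (constant? a) (concatMap (λ b → map (b ∷_) (allVec m n)) (allFin m)) ≡⟨ count-concatMap (constant? a) _ (allFin m) ⟩
  sum (map (λ b → count (constant? a) (map (b ∷_) (allVec m n))) (allFin m))  ≡⟨ sum-map-indicator (_≟ᶠ a) _ head-a head-≢a (allFin m) ⟩
  count (_≟ᶠ a) (allFin m) * 1                                                 ≡⟨ cong (_* 1) (count-≡-allFin a) ⟩
  1                                                                             ∎
  where
  open ≡-Reasoning
  head-a : ∀ {b} → b ≡ a → count (constant? a) (map (b ∷_) (allVec m n)) ≡ 1
  head-a refl = trans (count-map (constant? a) (a ∷_) (allVec m n))
    (trans (cong length (filter-≐ _ (constant? a) ((λ { (_ ∷ c) → c }) , (refl ∷_)) (allVec m n)))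
      (count-constant-allVec m n a))
  head-≢a : ∀ {b} → b ≢ a → count (constant? a) (map (b ∷_) (allVec m n)) ≡ 0
  head-≢a b≢a = trans (count-map (constant? a) _ (allVec m n))
    (count-empty _ (λ { _ (b≡a ∷ _) → b≢a b≡a }) (allVec m n))

module _ {m K : ℕ} {f : Fin K → ℕ} where

  ConstantOn : Pred (Fin K) 0ℓ → Fin m → ((i : Fin K) → Vec (Fin m) (f i)) → Set
  ConstantOn Z a g = ∀ i → Z i → Constant a (g i)

  constantOn? : {Z : Pred (Fin K) 0ℓ} → Decidable Z → (a : Fin m) → Decidable (ConstantOn Z a)
  constantOn? Z? a g = allᶠ? (λ i → Z? i →-dec constant? a (g i))

lengthOutside : ∀ {K} {Z : Pred (Fin K) 0ℓ} → Decidable Z → (Fin K → ℕ) → ℕ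
lengthOutside Z? f = sum (tabulate (λ i → if does (Z? i) then 0 else f i))

count-constantOn-allDep : ∀ m K (f : Fin K → ℕ) {Z : Pred (Fin K) 0ℓ} (Z? : Decidable Z) (a : Fin m) →
  count (constantOn? Z? a) (allDep m K f) ≡ m ^ lengthOutside Z? f
count-constantOn-allDep m zero f Z? a = refl
count-constantOn-allDep m (suc K) f {Z} Z? a =
  trans (count-concatMap (constantOn? Z? a) _ (allVec m (f zero))) (by-head (Z? zero))
  where
  open ≡-Reasoning
  gs : List ((i : Fin K) → Vec (Fin m) (f (suc i)))
  gs = allDep m K (f ∘ suc)
  rest : ℕ
  rest = lengthOutside (Z? ∘ suc) (f ∘ suc)
  countWithHead : Vec (Fin m) (f zero) → ℕ
  countWithHead v = count (constantOn? Z? a) (map (consD f v) gs)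

  head-ok : ∀ v → (Z zero → Constant a v) → countWithHead v ≡ m ^ rest
  head-ok v ok = begin
    countWithHead v                         ≡⟨ count-map (constantOn? Z? a) (consD f v) gs ⟩
    count (constantOn? Z? a ∘ consD f v) gs ≡⟨ cong length (filter-≐ _ (constantOn? (Z? ∘ suc) a) on-tail gs) ⟩
    count (constantOn? (Z? ∘ suc) a) gs     ≡⟨ count-constantOn-allDep m K (f ∘ suc) (Z? ∘ suc) a ⟩
    m ^ rest                                ∎
    where
    on-tail : ConstantOn Z a ∘ consD f v ≐ ConstantOn (Z ∘ suc) a
    on-tail = (λ c i → c (suc i)) , (λ c → λ { zero → ok ; (suc i) → c i })

  head-bad : ∀ v → Z zero → ¬ Constant a v → countWithHead v ≡ 0
  head-bad v z ¬c = trans (count-map (constantOn? Z? a) (consD f v) gs)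
    (count-empty _ (λ g c → ¬c (c zero z)) gs)

  by-head : (z? : Dec (Z zero)) →
    sum (map countWithHead (allVec m (f zero))) ≡ m ^ ((if does z? then 0 else f zero) + rest)
  by-head (yes z) = begin
    sum (map countWithHead (allVec m (f zero)))
      ≡⟨ sum-map-indicator (constant? a) countWithHead (λ c → head-ok _ (λ _ → c)) (head-bad _ z) (allVec m (f zero)) ⟩
    count (constant? a) (allVec m (f zero)) * m ^ rest ≡⟨ cong (_* m ^ rest) (count-constant-allVec m (f zero) a) ⟩
    1 * m ^ rest                                       ≡⟨ *-identityˡ (m ^ rest) ⟩
    m ^ rest                                           ∎
  by-head (no ¬z) = begin
    sum (map countWithHead (allVec m (f zero)))
      ≡⟨ sum-map-const countWithHead (λ v → head-ok v (⊥-elim ∘ ¬z)) (allVec m (f zero)) ⟩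
    length (allVec m (f zero)) * m ^ rest ≡⟨ cong (_* m ^ rest) (length-allVec m (f zero)) ⟩
    m ^ f zero * m ^ rest                 ≡⟨ ^-distribˡ-+-* m (f zero) rest ⟨
    m ^ (f zero + rest)                   ∎

countMaps-≡ : ∀ {K} m (l : Fin K → ℕ) {P : Pred (Vertex l → Fin m) 0ℓ} (P? : Decidable P)
  {R : Pred (Fin m) 0ℓ} (R? : Decidable R) {Z : Pred (Fin K) 0ℓ} (Z? : Decidable Z) →
  (∀ a b g → P (toMap l a b g) ⇔ (b ≡ a × R a × ConstantOn Z a g)) →
  countMaps m l P? ≡ count R? (allFin m) * m ^ lengthOutside Z? (pred ∘ l)
countMaps-≡ {K} m l {P} P? {R} R? {Z} Z? P⇔ = begin
  countMaps m l P?                                    ≡⟨ count-concatMap P? _ (allFin m) ⟩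
  sum (map (λ a → count P? (mapsFrom a)) (allFin m)) ≡⟨ sum-map-indicator R? _ R-yes R-no (allFin m) ⟩
  count R? (allFin m) * M                             ∎
  where
  open ≡-Reasoning
  open Equivalence
  gs : List ((i : Fin K) → Vec (Fin m) (pred (l i)))
  gs = allDep m K (pred ∘ l)
  M : ℕ
  M = m ^ lengthOutside Z? (pred ∘ l)
  countWith : Fin m → Fin m → ℕ
  countWith a b = count P? (map (toMap l a b) gs)
  mapsFrom : Fin m → List (Vertex l → Fin m)
  mapsFrom a = concatMap (λ b → map (toMap l a b) gs) (allFin m)

  diagonal : ∀ {a} → R a → countWith a a ≡ M
  diagonal {a} r = begin
    countWith a a               ≡⟨ count-map P? (toMap l a a) gs ⟩
    count (P? ∘ toMap l a a) gs ≡⟨ cong length (filter-≐ _ (constantOn? Z? a) P≐constant gs) ⟩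
    count (constantOn? Z? a) gs ≡⟨ count-constantOn-allDep m K (pred ∘ l) Z? a ⟩
    M                           ∎
    where
    P≐constant : P ∘ toMap l a a ≐ ConstantOn Z a
    P≐constant = (λ p → proj₂ (proj₂ (to (P⇔ a a _) p))) , (λ c → from (P⇔ a a _) (refl , r , c))

  vanishes : ∀ {a b} → ¬ (b ≡ a × R a) → countWith a b ≡ 0
  vanishes {a} {b} ¬ok = trans (count-map P? (toMap l a b) gs)
    (count-empty _ (λ g p → let (b≡a , r , _) = to (P⇔ a b g) p in ¬ok (b≡a , r)) gs)

  R-yes : ∀ {a} → R a → count P? (mapsFrom a) ≡ M
  R-yes {a} r = begin
    count P? (mapsFrom a)              ≡⟨ count-concatMap P? _ (allFin m) ⟩
    sum (map (countWith a) (allFin m))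
      ≡⟨ sum-map-indicator (_≟ᶠ a) _ (λ { refl → diagonal r }) (λ b≢a → vanishes (b≢a ∘ proj₁)) (allFin m) ⟩
    count (_≟ᶠ a) (allFin m) * M       ≡⟨ cong (_* M) (count-≡-allFin a) ⟩
    1 * M                              ≡⟨ *-identityˡ M ⟩
    M                                  ∎

  R-no : ∀ {a} → ¬ R a → count P? (mapsFrom a) ≡ 0
  R-no {a} ¬r = begin
    count P? (mapsFrom a)              ≡⟨ count-concatMap P? _ (allFin m) ⟩
    sum (map (countWith a) (allFin m)) ≡⟨ sum-map-const _ (λ b → vanishes (¬r ∘ proj₂)) (allFin m) ⟩
    length (allFin m) * 0              ≡⟨ *-zeroʳ (length (allFin m)) ⟩
    0                                  ∎

except : ∀ {K} → Fin K → (Fin K → ℕ) → Fin K → ℕ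
except q h i = if does (i ≟ᶠ q) then 0 else h i

sum-tabulate-except : ∀ {K} (q : Fin K) (h : Fin K → ℕ) → sum (tabulate h) ≡ h q + sum (tabulate (except q h))
sum-tabulate-except {suc K} zero    h = refl
sum-tabulate-except {suc K} (suc q) h = trans (cong (_+_ (h zero)) (sum-tabulate-except q (h ∘ suc)))
  (x∙yz≈y∙xz +-commutativeSemigroup (h zero) (h (suc q)) _)

sum-tabulate-pred : ∀ {K} (h : Fin K → ℕ) → (∀ i → 1 ≤ h i) → sum (tabulate h) ≡ K + sum (tabulate (pred ∘ h))
sum-tabulate-pred {zero}  h _   = refl
sum-tabulate-pred {suc K} h h≥1 = begin
  h zero + sum (tabulate (h ∘ suc))
    ≡⟨ cong₂ _+_ (sym (suc-pred (h zero) ⦃ >-nonZero (h≥1 zero) ⦄)) (sum-tabulate-pred (h ∘ suc) (h≥1 ∘ suc)) ⟩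
  suc (pred (h zero)) + (K + sum (tabulate (pred ∘ h ∘ suc)))
    ≡⟨ cong suc (x∙yz≈y∙xz +-commutativeSemigroup (pred (h zero)) K _) ⟩
  suc K + sum (tabulate (pred ∘ h))
    ∎
  where open ≡-Reasoning

step : {X : Set} → (X → X) → ℕ → X → X
step π zero    = π
step π (suc _) = id

step-id : ∀ {X : Set} t (x : X) → step id t x ≡ x
step-id zero    x = refl
step-id (suc _) x = refl

step-chain : {X : Set} (h : ℕ → X) (π : X → X) (L : ℕ) →
  (∀ t → t < L → step π t (h t) ≡ h (suc t)) ⇔ (∀ t → t < L → h (suc t) ≡ π (h 0))
step-chain h π L = mk⇔ chain⇒ chain⇐
  where
  chain⇒ : (∀ t → t < L → step π t (h t) ≡ h (suc t)) → ∀ t → t < L → h (suc t) ≡ π (h 0)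
  chain⇒ H zero    lt = sym (H 0 lt)
  chain⇒ H (suc t) lt = trans (sym (H (suc t) lt)) (chain⇒ H t (<-trans (n<1+n t) lt))

  chain⇐ : (∀ t → t < L → h (suc t) ≡ π (h 0)) → ∀ t → t < L → step π t (h t) ≡ h (suc t)
  chain⇐ H zero    lt = sym (H 0 lt)
  chain⇐ H (suc t) lt = trans (H t (<-trans (n<1+n t) lt)) (sym (H (suc t) lt))

∀-Fin⇔∀-< : ∀ {n} {P : ℕ → Set} → (∀ (j : Fin n) → P (toℕ j)) ⇔ (∀ t → t < n → P t)
∀-Fin⇔∀-< {P = P} = mk⇔ (λ H t lt → subst P (toℕ-fromℕ< lt) (H (fromℕ< lt))) (λ H j → H (toℕ j) (toℕ<n j))

match≡step : ∀ {k m} (l : Fin k → ℕ) (σ : Fin k → Permutation′ m) i (j : Fin (l i)) x →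
  match l σ (i , j) x ≡ step (σ i ⟨$⟩ʳ_) (toℕ j) x
match≡step l σ i j x with toℕ j
... | zero  = refl
... | suc _ = refl

module _ {k : ℕ} (l : Fin k → ℕ) where

  pos-suc-< : ∀ i t → suc t < l i → Σ (Fin (pred (l i))) λ s → pos l i (suc t) ≡ inner i s × toℕ s ≡ t
  pos-suc-< i t lt with suc t <? l i
  ... | yes p = fromℕ< (pred-mono-≤ p) , refl , toℕ-fromℕ< (pred-mono-≤ p)
  ... | no ¬p = contradiction lt ¬p

  pos-suc-≥ : ∀ i t → l i ≤ suc t → pos l i (suc t) ≡ w
  pos-suc-≥ i t ge with suc t <? l i
  ... | yes p = contradiction (<-≤-trans p ge) (<-irrefl refl)
  ... | no _  = refl

  module _ {m : ℕ} (a b : Fin m) (g : (i : Fin k) → Vec (Fin m) (pred (l i))) where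

    path-values : ∀ i c → 1 ≤ l i →
      (∀ t → t < l i → toMap l a b g (pos l i (suc t)) ≡ c) ⇔ (b ≡ c × Constant c (g i))
    path-values i c 1≤l = mk⇔ values⇒ values⇐
      where
      f : Vertex l → Fin m
      f = toMap l a b g
      l≡ : suc (pred (l i)) ≡ l i
      l≡ = suc-pred (l i) ⦃ >-nonZero 1≤l ⦄

      values⇒ : (∀ t → t < l i → f (pos l i (suc t)) ≡ c) → b ≡ c × Constant c (g i)
      values⇒ H = trans (cong f (sym (pos-suc-≥ i _ (≤-reflexive (sym l≡))))) (H _ (≤-reflexive l≡)) ,
                  lookup⁻ at
        where
        at : ∀ s → lookup (g i) s ≡ c
        at s with pos-suc-< i (toℕ s) (<-≤-trans (s≤s (toℕ<n s)) (≤-reflexive l≡))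
        ... | s′ , eq , toℕs′≡ with toℕ-injective toℕs′≡
        ... | refl = trans (cong f (sym eq)) (H (toℕ s) (<-trans (toℕ<n s) (≤-reflexive l≡)))

      values⇐ : b ≡ c × Constant c (g i) → ∀ t → t < l i → f (pos l i (suc t)) ≡ c
      values⇐ (b≡c , const) t _ with <-cmp (suc t) (l i)
      ... | tri< lt _ _ = let s , eq , _ = pos-suc-< i t lt in trans (cong f eq) (lookup⁺ const s)
      ... | tri≈ _ eq _ = trans (cong f (pos-suc-≥ i t (≤-reflexive (sym eq)))) b≡c
      ... | tri> _ _ gt = trans (cong f (pos-suc-≥ i t (<⇒≤ gt))) b≡c

    path-edges : ∀ i (π : Fin m → Fin m) → 1 ≤ l i →
      (∀ (j : Fin (l i)) → step π (toℕ j) (toMap l a b g (end₁ l (i , j))) ≡ toMap l a b g (end₂ l (i , j)))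
        ⇔ (b ≡ π a × Constant (π a) (g i))
    path-edges i π 1≤l =
      path-values i (π a) 1≤l ⇔-∘ (step-chain (λ t → toMap l a b g (pos l i t)) π (l i) ⇔-∘ ∀-Fin⇔∀-<)

    path-InS : (σ : Fin k → Permutation′ m) → ∀ i → 1 ≤ l i →
      (∀ j → InS l σ (i , j) (toMap l a b g)) ⇔ (b ≡ σ i ⟨$⟩ʳ a × Constant (σ i ⟨$⟩ʳ a) (g i))
    path-InS σ i 1≤l = path-edges i (σ i ⟨$⟩ʳ_) 1≤l ⇔-∘
      mk⇔ (λ H j → trans (sym (match≡step l σ i j _)) (H j)) (λ H j → trans (match≡step l σ i j _) (H j))

    path-InB : ∀ i → 1 ≤ l i → (∀ j → InB l (i , j) (toMap l a b g)) ⇔ (b ≡ a × Constant a (g i))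
    path-InB i 1≤l = path-edges i id 1≤l ⇔-∘
      mk⇔ (λ H j → trans (step-id (toℕ j) _) (H j)) (λ H j → trans (sym (step-id (toℕ j) _)) (H j))

  Incident : Edge l → Vertex l → Set
  Incident e x = end₁ l e ≡ x ⊎ end₂ l e ≡ x

  edge-≡ : ∀ (e e′ : Edge l) → proj₁ e ≡ proj₁ e′ → toℕ (proj₂ e) ≡ toℕ (proj₂ e′) → e ≡ e′
  edge-≡ (i , j) (.i , j′) refl eq = cong (i ,_) (toℕ-injective eq)

  pos≡inner : ∀ i′ t {i} {s : Fin (pred (l i))} → pos l i′ t ≡ inner i s → i′ ≡ i × t ≡ suc (toℕ s)
  pos≡inner i′ (suc t) eq with suc t <? l i′
  pos≡inner i′ (suc t) refl | yes p = refl , cong suc (sym (toℕ-fromℕ< (pred-mono-≤ p)))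

  incident-inner : ∀ e {i} {s : Fin (pred (l i))} → Incident e (inner i s) →
    proj₁ e ≡ i × (toℕ (proj₂ e) ≡ toℕ s ⊎ toℕ (proj₂ e) ≡ suc (toℕ s))
  incident-inner (i′ , j) (inj₁ eq) = let i′≡i , t≡ = pos≡inner i′ (toℕ j) eq in i′≡i , inj₂ t≡
  incident-inner (i′ , j) (inj₂ eq) = let i′≡i , t≡ = pos≡inner i′ (suc (toℕ j)) eq in i′≡i , inj₁ (suc-injective t≡)

module Cyclic {n : ℕ} (3≤n : 3 ≤ n) where

  private
    0<n : 0 < n
    0<n = ≤-trans (s≤s z≤n) 3≤n

  next : Fin n → Fin n
  next a with suc (toℕ a) <? n
  ... | yes p = fromℕ< p
  ... | no _  = fromℕ< 0<n

  toℕ-next : ∀ a → (suc (toℕ a) < n × toℕ (next a) ≡ suc (toℕ a))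
                  ⊎ (suc (toℕ a) ≡ n × toℕ (next a) ≡ 0)
  toℕ-next a with suc (toℕ a) <? n
  ... | yes p = inj₁ (p , toℕ-fromℕ< p)
  ... | no ¬p = inj₂ (≤-antisym (toℕ<n a) (≤-pred (≰⇒> ¬p)) , toℕ-fromℕ< 0<n)

  private
    prevℕ : ℕ → ℕ
    prevℕ zero    = pred n
    prevℕ (suc t) = t

    prevℕ< : ∀ t → t < n → prevℕ t < n
    prevℕ< zero    _  = ≤-reflexive (suc-pred n ⦃ >-nonZero 0<n ⦄)
    prevℕ< (suc t) lt = <-trans (n<1+n t) lt

    toℕ-next-prevℕ : ∀ t → t < n → ∀ (a : Fin n) → toℕ a ≡ prevℕ t → toℕ (next a) ≡ t
    toℕ-next-prevℕ t lt a a≡ with toℕ-next a | t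
    ... | inj₁ (_ , e) | suc t′ = trans e (cong suc a≡)
    ... | inj₂ (_ , e) | zero   = e
    ... | inj₁ (p , _) | zero   =
      contradiction (subst (_< n) (trans (cong suc a≡) (suc-pred n ⦃ >-nonZero 0<n ⦄)) p) (<-irrefl refl)
    ... | inj₂ (p , _) | suc t′ = contradiction (subst (_< n) (trans (cong suc (sym a≡)) p) lt) (<-irrefl refl)

  prev : Fin n → Fin n
  prev a = fromℕ< (prevℕ< (toℕ a) (toℕ<n a))

  next-prev : ∀ a → next (prev a) ≡ a
  next-prev a = toℕ-injective (toℕ-next-prevℕ (toℕ a) (toℕ<n a) (prev a) (toℕ-fromℕ< _))

  private
    n≰2 : ∀ {m} → n ≡ m → m ≤ 2 → ⊥
    n≰2 refl m≤2 = contradiction (≤-trans 3≤n m≤2) λ { (s≤s (s≤s ())) }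

  next-≢ : ∀ a → next a ≢ a
  next-≢ a eq with toℕ-next a
  ... | inj₁ (_ , e) = 1+n≢n (trans (sym e) (cong toℕ eq))
  ... | inj₂ (p , e) = n≰2 (trans (sym p) (cong suc (trans (sym (cong toℕ eq)) e))) (s≤s z≤n)

  prev-≢ : ∀ a → prev a ≢ a
  prev-≢ a eq = next-≢ a (trans (cong next (sym eq)) (next-prev a))

  next²-≢ : ∀ a → next (next a) ≢ a
  next²-≢ a eq with toℕ-next a | toℕ-next (next a)
  ... | inj₁ (_ , e) | inj₁ (_ , e′) =
    contradiction (trans (cong toℕ (sym eq)) (trans e′ (cong suc e))) (<⇒≢ (≤-trans (n<1+n _) (n≤1+n _)))
  ... | inj₁ (_ , e) | inj₂ (p′ , e′) =
    n≰2 (trans (sym p′) (trans (cong suc e) (cong (λ x → suc (suc x)) (trans (cong toℕ (sym eq)) e′)))) ≤-refl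
  ... | inj₂ (p , e) | inj₁ (_ , e′) =
    n≰2 (trans (sym p) (cong suc (trans (cong toℕ (sym eq)) (trans e′ (cong suc e))))) ≤-refl
  ... | inj₂ (_ , e) | inj₂ (p′ , _) = n≰2 (trans (sym p′) (cong suc e)) (s≤s z≤n)

module CycleIn {k : ℕ} (l : Fin k → ℕ) {F : List (Edge l)} {c : ℕ} (cycle : HasCycle l F c) where

  open Cyclic (proj₁ (proj₂ cycle)) public

  private
    v : Fin (suc c) → Vertex l
    v = proj₁ cycle

  V : Fin c → Vertex l
  V a = v (inject₁ a)

  V-injective : ∀ {a b} → V a ≡ V b → a ≡ b
  V-injective = proj₁ (proj₂ (proj₂ (proj₂ cycle))) _ _

  E : Fin c → Edge l
  E a = proj₁ (proj₂ (proj₂ (proj₂ (proj₂ cycle))) a)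

  E∈F : ∀ a → E a ∈ F
  E∈F a = proj₁ (proj₂ (proj₂ (proj₂ (proj₂ (proj₂ cycle))) a))

  private
    v-suc : ∀ a → v (suc a) ≡ V (next a)
    v-suc a with toℕ-next a
    ... | inj₁ (_ , e) = cong v (toℕ-injective (trans (sym e) (sym (toℕ-inject₁ (next a)))))
    ... | inj₂ (p , e) = begin
      v (suc a)   ≡⟨ cong v (toℕ-injective (trans p (sym (toℕ-fromℕ c)))) ⟩
      v (fromℕ c) ≡⟨ proj₁ (proj₂ (proj₂ cycle)) ⟨
      v zero      ≡⟨ cong v (toℕ-injective (sym (trans (toℕ-inject₁ (next a)) e))) ⟩
      V (next a)  ∎
      where open ≡-Reasoning

  E-joins : ∀ a → Joins l (E a) (V a) (V (next a))
  E-joins a with proj₂ (proj₂ (proj₂ (proj₂ (proj₂ (proj₂ cycle))) a))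
  ... | inj₁ (x , y) = inj₁ (x , trans y (v-suc a))
  ... | inj₂ (x , y) = inj₂ (trans x (v-suc a) , y)

  private
    same-end : ∀ (end : Edge l → Vertex l) {a b p q} → E a ≡ E b → end (E a) ≡ p → end (E b) ≡ q → p ≡ q
    same-end end eq x x′ = trans (sym x) (trans (cong end eq) x′)

  -- An edge traversed in both directions would give a cycle of length 2.
  E-injective : ∀ {a b} → E a ≡ E b → a ≡ b
  E-injective {a} {b} eq with E-joins a | E-joins b
  ... | inj₁ (x , _) | inj₁ (x′ , _) = V-injective (same-end (end₁ l) eq x x′)
  ... | inj₂ (_ , y) | inj₂ (_ , y′) = V-injective (same-end (end₂ l) eq y y′)
  ... | inj₁ (x , y) | inj₂ (x′ , y′) = contradiction
    (trans (cong next (sym (V-injective (same-end (end₁ l) eq x x′)))) (V-injective (same-end (end₂ l) eq y y′))) (next²-≢ b)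
  ... | inj₂ (x , y) | inj₁ (x′ , y′) = contradiction
    (trans (cong next (V-injective (same-end (end₁ l) eq x x′))) (sym (V-injective (same-end (end₂ l) eq y y′)))) (next²-≢ a)


  OnCycle : Fin k → ℕ → Set
  OnCycle i t = Σ (Fin c) λ a → proj₁ (E a) ≡ i × toℕ (proj₂ (E a)) ≡ t

  private
    leaves : ∀ b → Incident l (E b) (V b)
    leaves b with E-joins b
    ... | inj₁ (x , _) = inj₁ x
    ... | inj₂ (_ , y) = inj₂ y

    enters : ∀ a → Incident l (E a) (V (next a))
    enters a with E-joins a
    ... | inj₁ (_ , y) = inj₂ y
    ... | inj₂ (x , _) = inj₁ x

    endpoint-on-cycle : ∀ a {x} → Incident l (E a) x → Σ (Fin c) λ b → V b ≡ x
    endpoint-on-cycle a inc with E-joins a | inc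
    ... | inj₁ (x , _) | inj₁ e = a , trans (sym x) e
    ... | inj₁ (_ , y) | inj₂ e = next a , trans (sym y) e
    ... | inj₂ (x , _) | inj₁ e = next a , trans (sym x) e
    ... | inj₂ (_ , y) | inj₂ e = a , trans (sym y) e

  -- The cycle leaves V b along E b and enters it along E (prev b); these are distinct, and an
  -- inner vertex of a path is incident only to the two edges of that path around it.
  through-inner : ∀ {i} {s : Fin (pred (l i))} b → V b ≡ inner i s →
    OnCycle i (toℕ s) × OnCycle i (suc (toℕ s))
  through-inner b eq
    with incident-inner l (E b) (subst (Incident l _) eq (leaves b))
       | incident-inner l (E (prev b)) (subst (Incident l _) (trans (cong V (next-prev b)) eq) (enters (prev b)))
  ... | p₁ , inj₁ t₁ | p₂ , inj₂ t₂ = (b , p₁ , t₁) , (prev b , p₂ , t₂)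
  ... | p₁ , inj₂ t₁ | p₂ , inj₁ t₂ = (prev b , p₂ , t₂) , (b , p₁ , t₁)
  ... | p₁ , inj₁ t₁ | p₂ , inj₁ t₂ =
    contradiction (sym (E-injective (edge-≡ l _ _ (trans p₁ (sym p₂)) (trans t₁ (sym t₂))))) (prev-≢ b)
  ... | p₁ , inj₂ t₁ | p₂ , inj₂ t₂ =
    contradiction (sym (E-injective (edge-≡ l _ _ (trans p₁ (sym p₂)) (trans t₁ (sym t₂))))) (prev-≢ b)

  private
    around : ∀ {i n} → suc n < l i → (Σ (Fin c) λ a → Incident l (E a) (pos l i (suc n))) →
      OnCycle i n × OnCycle i (suc n)
    around {i} {n} lt (a , inc) with pos-suc-< l i n lt | endpoint-on-cycle a inc
    ... | s , pos≡ , refl | b , Vb≡ = through-inner b (trans Vb≡ pos≡)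

    up : ∀ {i n} → suc n < l i → OnCycle i n → OnCycle i (suc n)
    up lt (a , p , q) = proj₂ (around lt (a , inj₂ (cong₂ (λ i t → pos l i (suc t)) p q)))

    down : ∀ {i n} → suc n < l i → OnCycle i (suc n) → OnCycle i n
    down lt (a , p , q) = proj₁ (around lt (a , inj₁ (cong₂ (pos l) p q)))

    down-to-0 : ∀ {i} n → n < l i → OnCycle i n → OnCycle i 0
    down-to-0 zero    _  h = h
    down-to-0 (suc n) lt h = down-to-0 n (<-trans (n<1+n n) lt) (down lt h)

    up-from-0 : ∀ {i} n → n < l i → OnCycle i 0 → OnCycle i n
    up-from-0 zero    _  h = h
    up-from-0 (suc n) lt h = up lt (up-from-0 n (<-trans (n<1+n n) lt) h)

  cycle-covers-path : ∀ a (j : Fin (l (proj₁ (E a)))) → (proj₁ (E a) , j) ∈ F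
  cycle-covers-path a j with up-from-0 (toℕ j) (toℕ<n j) (down-to-0 _ (toℕ<n (proj₂ (E a))) (a , refl , refl))
  ... | b , p , q = subst (_∈ F) (edge-≡ l (E b) _ p q) (E∈F b)

OnTwoPaths : ∀ {k} → Fin (suc k) → Fin (suc k) → Set
OnTwoPaths ν i = i ≡ ν ⊎ i ≡ zero

onTwoPaths? : ∀ {k} (ν : Fin (suc k)) → Decidable (OnTwoPaths ν)
onTwoPaths? ν i = (i ≟ᶠ ν) ⊎-dec (i ≟ᶠ zero)

module _ {k : ℕ} (l : Fin (suc k) → ℕ) {ν : Fin (suc k)} {F : List (Edge l)} where

  private
    _≟ₑ_ : (e e′ : Edge l) → Dec (e ≡ e′)
    _≟ₑ_ = ≡-dec _≟ᶠ_ _≟ᶠ_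

    pathEdge-injective : ∀ {i} {j j′ : Fin (l i)} → _≡_ {A = Edge l} (i , j) (i , j′) → j ≡ j′
    pathEdge-injective refl = refl

  PathIn : Fin (suc k) → Set
  PathIn i = ∀ j → (i , j) ∈ F

  module _ (1≤l₀ : 1 ≤ l zero) (shortest : ∀ p → p ≢ zero → l zero < l p) (|F| : length F ≡ l zero + l ν)
           (cycle : HasCycle l F (l zero + l ν)) (ν∈F : Σ (Fin (l ν)) λ j → (ν , j) ∈ F) where

    open CycleIn l cycle

    -- The l zero + l ν distinct cycle edges already fill F.
    F⊆cycle : ∀ {e} → e ∈ F → Σ (Fin (l zero + l ν)) λ a → E a ≡ e
    F⊆cycle {e} e∈F with any? (λ a → E a ≟ₑ e)
    ... | yes found = found
    ... | no ¬found = contradiction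
      (≤-trans (injective-∈⇒≤-length ((λ _ → e) ++ E) extra-injective extra-∈) (≤-reflexive |F|)) (<-irrefl refl)
      where
      extra-injective : Injective _≡_ _≡_ ((λ (_ : Fin 1) → e) ++ E)
      extra-injective = ++-injective (λ { {zero} {zero} _ → refl }) E-injective (λ _ a e≡ → ¬found (a , sym e≡))
      extra-∈ : ∀ x → ((λ (_ : Fin 1) → e) ++ E) x ∈ F
      extra-∈ = ++⁺ (_∈ F) (λ _ → e∈F) E∈F

    PathIn-of-∈ : ∀ {e} → e ∈ F → PathIn (proj₁ e)
    PathIn-of-∈ e∈F j with F⊆cycle e∈F
    ... | a , refl = cycle-covers-path a j

    PathIn⇒≡zero : ∀ {p} → p ≢ ν → PathIn p → p ≡ zero
    PathIn⇒≡zero {p} p≢ν pF with p ≟ᶠ zero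
    ... | yes p≡0 = p≡0
    ... | no p≢0 = contradiction (+-cancelˡ-≤ (l ν) (l p) (l zero) both-paths) (<⇒≱ (shortest p p≢0))
      where
      ν-edge : Fin (l ν) → Edge l
      ν-edge = ν ,_
      p-edge : Fin (l p) → Edge l
      p-edge = p ,_
      both-paths : l ν + l p ≤ l ν + l zero
      both-paths = ≤-trans
        (injective-∈⇒≤-length (ν-edge ++ p-edge)
          (++-injective pathEdge-injective pathEdge-injective (λ _ _ eq → p≢ν (sym (cong proj₁ eq))))
          (++⁺ (_∈ F) (PathIn-of-∈ (proj₂ ν∈F)) pF))
        (≤-reflexive (trans |F| (+-comm (l zero) (l ν))))

    cycle-leaves-path-ν : Σ (Fin (l zero + l ν)) λ a → proj₁ (E a) ≢ ν
    cycle-leaves-path-ν = ¬∀⟶∃¬ _ _ (λ a → proj₁ (E a) ≟ᶠ ν) λ on-ν → contradiction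
      (≤-trans (injective-∈⇒≤-length E E-injective (λ a → on-path (E a) (on-ν a))) (≤-reflexive |pathν|))
      (<⇒≱ (+-monoˡ-< (l ν) 1≤l₀))
      where
      pathν : List (Edge l)
      pathν = map {B = Edge l} (ν ,_) (allFin (l ν))
      |pathν| : length pathν ≡ l ν
      |pathν| = trans (length-map {B = Edge l} (ν ,_) (allFin (l ν))) (length-allFin (l ν))
      on-path : ∀ e → proj₁ e ≡ ν → e ∈ pathν
      on-path (_ , j) refl = ∈-map⁺ (ν ,_) (∈-allFin j)

    PathIn-zero : PathIn zero
    PathIn-zero = let a , off-ν = cycle-leaves-path-ν in
      subst PathIn (PathIn⇒≡zero off-ν (PathIn-of-∈ (E∈F a))) (PathIn-of-∈ (E∈F a))

    cycle-through-two-paths : ∀ e → e ∈ F ⇔ OnTwoPaths ν (proj₁ e)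
    cycle-through-two-paths (i , j) = mk⇔ on-two-paths in-F
      where
      on-two-paths : (i , j) ∈ F → OnTwoPaths ν i
      on-two-paths e∈F with i ≟ᶠ ν
      ... | yes i≡ν = inj₁ i≡ν
      ... | no i≢ν = inj₂ (PathIn⇒≡zero i≢ν (PathIn-of-∈ e∈F))

      in-F : OnTwoPaths ν i → (i , j) ∈ F
      in-F (inj₁ refl) = PathIn-of-∈ (proj₂ ν∈F) j
      in-F (inj₂ refl) = PathIn-zero j

module _ {k : ℕ} (l : Fin (suc (suc k)) → ℕ) {ν : Fin (suc (suc k))} (ν≢0 : ν ≢ zero) (l≥1 : ∀ i → 1 ≤ l i) where

  nVert∸two-paths : nVert l ∸ l zero ∸ l ν ≡ lengthOutside (onTwoPaths? ν) (pred ∘ l)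
  nVert∸two-paths = begin
    totalLen l + 2 ∸ K ∸ l zero ∸ l ν
      ≡⟨ cong (λ x → x + 2 ∸ K ∸ l zero ∸ l ν) totalLen≡ ⟩
    K + (pred (l zero) + (pred (l ν) + R)) + 2 ∸ K ∸ l zero ∸ l ν
      ≡⟨ cong (λ x → x ∸ K ∸ l zero ∸ l ν) (+-assoc K _ 2) ⟩
    K + (pred (l zero) + (pred (l ν) + R) + 2) ∸ K ∸ l zero ∸ l ν
      ≡⟨ cong (λ x → x ∸ l zero ∸ l ν) (m+n∸m≡n K _) ⟩
    pred (l zero) + (pred (l ν) + R) + 2 ∸ l zero ∸ l ν
      ≡⟨ cong (λ x → x ∸ l zero ∸ l ν) (unpred (l zero) (l ν) (l≥1 zero) (l≥1 ν)) ⟩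
    l zero + (l ν + R) ∸ l zero ∸ l ν
      ≡⟨ cong (_∸ l ν) (m+n∸m≡n (l zero) _) ⟩
    l ν + R ∸ l ν
      ≡⟨ m+n∸m≡n (l ν) R ⟩
    R ∎
    where
    open ≡-Reasoning
    K R : ℕ
    K = suc (suc k)
    R = lengthOutside (onTwoPaths? ν) (pred ∘ l)

    except-zero-at-ν : except zero (pred ∘ l) ν ≡ pred (l ν)
    except-zero-at-ν with ν ≟ᶠ zero
    ... | yes ν≡0 = contradiction ν≡0 ν≢0
    ... | no _    = refl

    except-both : ∀ i → except ν (except zero (pred ∘ l)) i ≡ (if does (onTwoPaths? ν i) then 0 else pred (l i))
    except-both i with does (i ≟ᶠ ν)
    ... | true  = refl
    ... | false = refl

    totalLen≡ : totalLen l ≡ K + (pred (l zero) + (pred (l ν) + R))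
    totalLen≡ = begin
      sum (map l (allFin K))
        ≡⟨ cong sum (map-tabulate (λ i → i) l) ⟩
      sum (tabulate l)
        ≡⟨ sum-tabulate-pred l l≥1 ⟩
      K + sum (tabulate (pred ∘ l))
        ≡⟨ cong (_+_ K) (sum-tabulate-except zero (pred ∘ l)) ⟩
      K + (pred (l zero) + sum (tabulate (except zero (pred ∘ l))))
        ≡⟨ cong (λ x → K + (pred (l zero) + x)) (sum-tabulate-except ν (except zero (pred ∘ l))) ⟩
      K + (pred (l zero) + (except zero (pred ∘ l) ν + sum (tabulate (except ν (except zero (pred ∘ l))))))
        ≡⟨ cong (λ x → K + (pred (l zero) + x)) (cong₂ _+_ except-zero-at-ν (cong sum (tabulate-cong except-both))) ⟩
      K + (pred (l zero) + (pred (l ν) + R))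
        ∎

    unpred : ∀ x y {r} → 1 ≤ x → 1 ≤ y → pred x + (pred y + r) + 2 ≡ x + (y + r)
    unpred (suc x) (suc y) {r} _ _ = trans (+-comm (x + (y + r)) 2) (cong suc (sym (+-suc x (y + r))))

module _ {k m : ℕ} (l : Fin (suc k) → ℕ) {ν : Fin (suc k)} {F : List (Edge l)}
         (F≡paths : ∀ e → e ∈ F ⇔ OnTwoPaths ν (proj₁ e)) (l≥1 : ∀ i → 1 ≤ l i) where

  open Equivalence

  All-⇔-two-paths : {P : Edge l → Set} → All P F ⇔ (∀ i → OnTwoPaths ν i → ∀ j → P (i , j))
  All-⇔-two-paths = mk⇔ (λ all i on j → All.lookup all (from (F≡paths (i , j)) on))
                (λ H → All.tabulate (λ {e} e∈F → H (proj₁ e) (to (F≡paths e) e∈F) (proj₂ e)))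

  private
    Constant-≡ : ∀ {n} {c d : Fin m} {v : Vec (Fin m) n} → c ≡ d → Constant c v → Constant d v
    Constant-≡ refl c = c

  All-InS⇔ : (σ : Fin (suc k) → Permutation′ m) → (∀ a → σ zero ⟨$⟩ʳ a ≡ a) → ∀ a b g →
    All (λ e → InS l σ e (toMap l a b g)) F ⇔ (b ≡ a × σ ν ⟨$⟩ʳ a ≡ a × ConstantOn (OnTwoPaths ν) a g)
  All-InS⇔ σ σ₀ a b g = mk⇔ S⇒ S⇐
    where
    f : Vertex l → Fin m
    f = toMap l a b g
    path₀ : (∀ j → InS l σ (zero , j) f) ⇔ (b ≡ σ zero ⟨$⟩ʳ a × Constant (σ zero ⟨$⟩ʳ a) (g zero))
    path₀ = path-InS l a b g σ zero (l≥1 zero)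
    pathν : (∀ j → InS l σ (ν , j) f) ⇔ (b ≡ σ ν ⟨$⟩ʳ a × Constant (σ ν ⟨$⟩ʳ a) (g ν))
    pathν = path-InS l a b g σ ν (l≥1 ν)

    S⇒ : All (λ e → InS l σ e f) F → b ≡ a × σ ν ⟨$⟩ʳ a ≡ a × ConstantOn (OnTwoPaths ν) a g
    S⇒ inS = b≡a , fixed ,
      λ { i (inj₁ refl) → Constant-≡ fixed (proj₂ onν) ; i (inj₂ refl) → Constant-≡ (σ₀ a) (proj₂ on₀) }
      where
      on₀ : b ≡ σ zero ⟨$⟩ʳ a × Constant (σ zero ⟨$⟩ʳ a) (g zero)
      on₀ = to path₀ (to All-⇔-two-paths inS zero (inj₂ refl))
      onν : b ≡ σ ν ⟨$⟩ʳ a × Constant (σ ν ⟨$⟩ʳ a) (g ν)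
      onν = to pathν (to All-⇔-two-paths inS ν (inj₁ refl))
      b≡a : b ≡ a
      b≡a = trans (proj₁ on₀) (σ₀ a)
      fixed : σ ν ⟨$⟩ʳ a ≡ a
      fixed = trans (sym (proj₁ onν)) b≡a

    S⇐ : b ≡ a × σ ν ⟨$⟩ʳ a ≡ a × ConstantOn (OnTwoPaths ν) a g → All (λ e → InS l σ e f) F
    S⇐ (b≡a , fixed , const) = from All-⇔-two-paths λ
      { i (inj₁ refl) → from pathν (trans b≡a (sym fixed) , Constant-≡ (sym fixed) (const ν (inj₁ refl)))
      ; i (inj₂ refl) → from path₀ (trans b≡a (sym (σ₀ a)) , Constant-≡ (sym (σ₀ a)) (const zero (inj₂ refl))) }

  All-InB⇔ : ∀ a b g → All (λ e → InB l e (toMap l a b g)) F ⇔ (b ≡ a × U a × ConstantOn (OnTwoPaths ν) a g)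
  All-InB⇔ a b g = mk⇔
    (λ inB → proj₁ (to path₀ (on zero (inj₂ refl) inB)) , _ ,
      λ { i (inj₁ refl) → proj₂ (to pathν (on ν (inj₁ refl) inB))
        ; i (inj₂ refl) → proj₂ (to path₀ (on zero (inj₂ refl) inB)) })
    (λ (b≡a , _ , const) → from All-⇔-two-paths λ
      { i (inj₁ refl) → from pathν (b≡a , const ν (inj₁ refl))
      ; i (inj₂ refl) → from path₀ (b≡a , const zero (inj₂ refl)) })
    where
    f : Vertex l → Fin m
    f = toMap l a b g
    on : ∀ i → OnTwoPaths ν i → All (λ e → InB l e f) F → ∀ j → InB l (i , j) f
    on i i∈ inB = to All-⇔-two-paths inB i i∈
    path₀ : (∀ j → InB l (zero , j) f) ⇔ (b ≡ a × Constant a (g zero))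
    path₀ = path-InB l a b g zero (l≥1 zero)
    pathν : (∀ j → InB l (ν , j) f) ⇔ (b ≡ a × Constant a (g ν))
    pathν = path-InB l a b g ν (l≥1 ν)

  sizeS≡ : (σ : Fin (suc k) → Permutation′ m) → (∀ a → σ zero ⟨$⟩ʳ a ≡ a) →
    sizeS m l σ F ≡ count (λ a → σ ν ⟨$⟩ʳ a ≟ᶠ a) (allFin m) * m ^ lengthOutside (onTwoPaths? ν) (pred ∘ l)
  sizeS≡ σ σ₀ = countMaps-≡ m l _ (λ a → σ ν ⟨$⟩ʳ a ≟ᶠ a) (onTwoPaths? ν) (All-InS⇔ σ σ₀)

  sizeB≡ : sizeB m l F ≡ count U? (allFin m) * m ^ lengthOutside (onTwoPaths? ν) (pred ∘ l)
  sizeB≡ = countMaps-≡ m l _ U? (onTwoPaths? ν) All-InB⇔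

module _ {k : ℕ} (l : Fin (suc (suc k)) → ℕ) (mono : ∀ i j → 1 ≤ toℕ i → toℕ i ≤ toℕ j → l i ≤ l j) where

  paths-nonempty : 1 ≤ l zero → 2 ≤ l (suc zero) → ∀ i → 1 ≤ l i
  paths-nonempty l₀≥1 _    zero    = l₀≥1
  paths-nonempty _    l₁≥2 (suc i) = ≤-trans (s≤s z≤n) (≤-trans l₁≥2 (mono (suc zero) (suc i) (s≤s z≤n) (s≤s z≤n)))

  first-path-shortest : l zero ≤ l (suc zero) → (∀ j → 1 ≤ toℕ j → l zero % 2 ≢ l j % 2) →
    ∀ p → p ≢ zero → l zero < l p
  first-path-shortest _     _      zero    p≢0 = contradiction refl p≢0
  first-path-shortest l₀≤l₁ parity (suc p) _   =
    ≤∧≢⇒< (≤-trans l₀≤l₁ (mono (suc zero) (suc p) (s≤s z≤n) (s≤s z≤n))) (parity (suc p) (s≤s z≤n) ∘ cong (_% 2))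

+m-+[m+n]≡-+n : ∀ m n → + m - + (m + n) ≡ - + n
+m-+[m+n]≡-+n m n = trans (ℤ.[+m]-[+n]≡m⊖n m (m + n)) (trans (ℤ.⊖-≤ (m≤m+n m n)) (cong (-_ ∘ +_) (m+n∸m≡n m n)))

lemma3p5 : (k m : ℕ) (l : Fin (suc (suc k)) → ℕ) (σ : Fin (suc (suc k)) → Permutation′ m) →
  1 ≤ l zero →
  2 ≤ l (suc zero) → l zero ≤ l (suc zero) →
  (∀ i j → 1 ≤ toℕ i → toℕ i ≤ toℕ j → l i ≤ l j) →
  (∀ j → 1 ≤ toℕ j → l zero % 2 ≢ l j % 2) →
  (∀ a → σ zero ⟨$⟩ʳ a ≡ a) →
  (μ : Fin (suc (suc k))) → 1 ≤ toℕ μ → 0 < xcount (σ μ) →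
  (∀ i → 1 ≤ toℕ i → toℕ i < toℕ μ → xcount (σ i) ≡ 0) →
  (t : ℕ) → length (filter (λ i → l i ≟ l μ) (allFin (suc (suc k)))) ≡ t →
  (∀ r → r < t → Σ (Fin (suc (suc k))) λ ν → toℕ ν ≡ toℕ μ + r × l ν ≡ l μ) →
  (F : List (Edge l)) → Unique F → length F ≡ l zero + l μ →
  HasCycle l F (l zero + l μ) →
  (r : ℕ) → r < t → (ν : Fin (suc (suc k))) → toℕ ν ≡ toℕ μ + r →
  Σ (Fin (l ν)) (λ j → toℕ j ≡ 0 × (ν , j) ∈ F) →
  (+ sizeS m l σ F) - (+ sizeB m l F)
    ≡ - (+ (xcount (σ ν) * m ^ (nVert l ∸ l zero ∸ l μ)))
-- Uniqueness of F and the hypotheses singling out μ (x_μ > 0, minimality, the value of t) are not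
-- needed: it suffices that path ν has length l_μ.
lemma3p5 k m l σ l₀≥1 l₁≥2 l₀≤l₁ mono parity σ₀ μ μ≥1 _ _ t _ block F _ |F| cycle r r<t ν ν≡μ+r (j₀ , _ , ν∈F) =
  begin
    + sizeS m l σ F - + sizeB m l F                   ≡⟨ cong₂ (λ s b → + s - + b) |S| |B| ⟩
    + (fixed * M) - + ((fixed + moved) * M)           ≡⟨ cong (λ x → + (fixed * M) - + x) (*-distribʳ-+ M fixed moved) ⟩
    + (fixed * M) - + (fixed * M + moved * M)         ≡⟨ +m-+[m+n]≡-+n (fixed * M) (moved * M) ⟩
    - + (moved * M)                                   ≡⟨ cong (λ e → - + (moved * m ^ e)) exponent ⟩
    - + (xcount (σ ν) * m ^ (nVert l ∸ l zero ∸ l μ)) ∎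
  where
  open ≡-Reasoning
  lν≡lμ : l ν ≡ l μ
  lν≡lμ with block r r<t
  ... | ν′ , ν′≡μ+r , lν′≡lμ = trans (cong l (toℕ-injective (trans ν≡μ+r (sym ν′≡μ+r)))) lν′≡lμ

  ν≢0 : ν ≢ zero
  ν≢0 ν≡0 with ≤-trans μ≥1 (≤-trans (m≤m+n (toℕ μ) r) (≤-reflexive (trans (sym ν≡μ+r) (cong toℕ ν≡0))))
  ... | ()

  l≥1 : ∀ i → 1 ≤ l i
  l≥1 = paths-nonempty l mono l₀≥1 l₁≥2

  F≡paths : ∀ e → e ∈ F ⇔ OnTwoPaths ν (proj₁ e)
  F≡paths = cycle-through-two-paths l l₀≥1 (first-path-shortest l mono l₀≤l₁ parity)
    (trans |F| (cong (λ x → l zero + x) (sym lν≡lμ)))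
    (subst (λ x → HasCycle l F (l zero + x)) (sym lν≡lμ) cycle)
    (j₀ , ν∈F)

  M fixed moved : ℕ
  M = m ^ lengthOutside (onTwoPaths? ν) (pred ∘ l)
  fixed = count (λ a → σ ν ⟨$⟩ʳ a ≟ᶠ a) (allFin m)
  moved = xcount (σ ν)

  |S| : sizeS m l σ F ≡ fixed * M
  |S| = sizeS≡ l F≡paths l≥1 σ σ₀

  |B| : sizeB m l F ≡ (fixed + moved) * M
  |B| = trans (sizeB≡ {m = m} l F≡paths l≥1) (cong (_* M) (begin
    count U? (allFin m)  ≡⟨ count-universal U? _ (allFin m) ⟩
    length (allFin m)    ≡⟨ count-+-count-¬ _ (allFin m) ⟨
    fixed + moved        ∎))

  exponent : lengthOutside (onTwoPaths? ν) (pred ∘ l) ≡ nVert l ∸ l zero ∸ l μ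
  exponent = trans (sym (nVert∸two-paths l ν≢0 l≥1)) (cong (nVert l ∸ l zero ∸_) lν≡lμ)
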